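{- Let $G=(V_B\cup V_R,E)$ be a bipartite graph with parts $V_B=\{b_1,\dots,b_m\}$ and $V_R=\{r_1,\dots,r_n\}$, in which every vertex of $V_R$ has at least one neighbour, and let $k\in\mathbb{N}$. Construct $G'$ from $G$ by adding new vertices $r'_1,\dots,r'_n$, where each $r'_i$ is made adjacent exactly to the neighbours of $r_i$ in $V_B$; let $\mathcal{T}=\{\{r_i,r'_i\}: i\in[n]\}$. Then there exists $D\subseteq V_B$ with $|D|\le k$ such that every vertex of $V_R$ is adjacent to some vertex of $D$ if and only if there exists $S\subseteq V(G')$ with $|S|\le k$ such that for every $\{r_i,r'_i\}\in\mathcal{T}$ there is $w\in S$ with $d_{G'}(r_i,w)+d_{G'}(w,r'_i)=d_{G'}(r_i,r'_i)$.
   Context: $d_{G'}$ denotes shortest-path distance in the unweighted graph $G'$. -}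

module Defs where

open import Data.Nat using (ℕ; zero; suc; _+_; _≤_)
open import Data.Fin using (Fin)
open import Data.Fin.Subset using (Subset; _∈_; ∣_∣)
open import Data.Bool using (Bool; T)
open import Data.Product using (_×_; Σ; ∃; _,_)
open import Relation.Binary.PropositionalEquality using (_≡_)

-- A bipartite graph G with parts V_B = Fin m (b_1..b_m) and V_R = Fin n (r_1..r_n),
-- given by its bipartite adjacency matrix: adj i j = true iff b_i r_j ∈ E.
BipGraph : ℕ → ℕ → Set
BipGraph m n = Fin m → Fin n → Bool

data V' (m n : ℕ) : Set where
  b  : Fin m → V' m n
  r  : Fin n → V' m n
  r' : Fin n → V' m n

data Edge' {m n : ℕ} (G : BipGraph m n) : V' m n → V' m n → Set where
  br  : ∀ i j → T (G i j) → Edge' G (b i) (r j)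
  rb  : ∀ i j → T (G i j) → Edge' G (r j) (b i)
  br' : ∀ i j → T (G i j) → Edge' G (b i) (r' j)
  r'b : ∀ i j → T (G i j) → Edge' G (r' j) (b i)

data Walk {m n : ℕ} (G : BipGraph m n) : V' m n → V' m n → ℕ → Set where
  here : ∀ {u} → Walk G u u 0
  step : ∀ {u v w ℓ} → Edge' G u v → Walk G v w ℓ → Walk G u w (suc ℓ)

-- d_{G'}(u,v) = d : shortest-path distance (only defined when finite).
Dist : ∀ {m n} (G : BipGraph m n) → V' m n → V' m n → ℕ → Set
Dist G u v d = Walk G u v d × (∀ ℓ → Walk G u v ℓ → d ≤ ℓ)

OnGeodesic : ∀ {m n} (G : BipGraph m n) → V' m n → V' m n → V' m n → Set
OnGeodesic G u w v =
  Σ ℕ λ d₁ → Σ ℕ λ d₂ → Σ ℕ λ d →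
    Dist G u w d₁ × Dist G w v d₂ × Dist G u v d × (d₁ + d₂ ≡ d)

record SubsetV' (m n : ℕ) : Set where
  constructor subsetV'
  field
    SB  : Subset m
    SR  : Subset n
    SR' : Subset n

_∈'_ : ∀ {m n} → V' m n → SubsetV' m n → Set
b i  ∈' S = i ∈ SubsetV'.SB S
r j  ∈' S = j ∈ SubsetV'.SR S
r' j ∈' S = j ∈ SubsetV'.SR' S

size' : ∀ {m n} → SubsetV' m n → ℕ
size' S = ∣ SubsetV'.SB S ∣ + ∣ SubsetV'.SR S ∣ + ∣ SubsetV'.SR' S ∣

{-# OPTIONS --safe #-}
-- In G' a walk r j → r' j needs two steps and, when r j has a neighbour, two steps
-- suffice; so the vertices on r j – r' j geodesics are exactly r j, r' j and the
-- neighbours of r j. Hence a dominating set D ⊆ V_B meets all these geodesics, and conversely,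
-- replacing each r j or r' j in S by a fixed neighbour of r j turns S into a
-- dominating subset of V_B of no larger size.
module Submission where

open import Defs
open import Data.Nat using (ℕ; _+_; _≤_; z≤n; s≤s)
open import Data.Nat.Properties
  using (≤-trans; ≤-reflexive; n≤1+n; +-suc; +-identityʳ; +-mono-≤; +-monoʳ-≤; m+n≤o⇒n≤o)
open import Data.Fin using (Fin; zero; suc)
open import Data.Fin.Subset using (Subset; _∈_; ∣_∣; _∪_; ⁅_⁆; ⊥)
open import Data.Fin.Subset.Properties using (∣⊥∣≡0; ∣⁅x⁆∣≡1; x∈⁅x⁆; p⊆p∪q; q⊆p∪q)
open import Data.Vec using ([]; _∷_; here; there)
open import Data.Bool using (T; true; false)
open import Data.Product using (_×_; ∃-syntax; _,_; proj₁; proj₂)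
open import Data.Empty using (⊥-elim)
open import Function.Bundles using (_⇔_; mk⇔)
open import Relation.Binary.PropositionalEquality using (_≡_; refl; sym)
open import Relation.Nullary using (¬_)

∣p∪q∣≤∣p∣+∣q∣ : ∀ {n} (p q : Subset n) → ∣ p ∪ q ∣ ≤ ∣ p ∣ + ∣ q ∣
∣p∪q∣≤∣p∣+∣q∣ []          []          = z≤n
∣p∪q∣≤∣p∣+∣q∣ (true ∷ p)  (true ∷ q)  =
  s≤s (≤-trans (∣p∪q∣≤∣p∣+∣q∣ p q) (+-monoʳ-≤ ∣ p ∣ (n≤1+n ∣ q ∣)))
∣p∪q∣≤∣p∣+∣q∣ (true ∷ p)  (false ∷ q) = s≤s (∣p∪q∣≤∣p∣+∣q∣ p q)
∣p∪q∣≤∣p∣+∣q∣ (false ∷ p) (true ∷ q)  =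
  ≤-trans (s≤s (∣p∪q∣≤∣p∣+∣q∣ p q)) (≤-reflexive (sym (+-suc ∣ p ∣ ∣ q ∣)))
∣p∪q∣≤∣p∣+∣q∣ (false ∷ p) (false ∷ q) = ∣p∪q∣≤∣p∣+∣q∣ p q

image : ∀ {n m} → (Fin n → Fin m) → Subset n → Subset m
image f []          = ⊥
image f (true ∷ p)  = ⁅ f zero ⁆ ∪ image (λ x → f (suc x)) p
image f (false ∷ p) = image (λ x → f (suc x)) p

∣image∣≤∣p∣ : ∀ {n m} (f : Fin n → Fin m) (p : Subset n) → ∣ image f p ∣ ≤ ∣ p ∣
∣image∣≤∣p∣ {m = m} f [] = ≤-reflexive (∣⊥∣≡0 m)
∣image∣≤∣p∣ f (true ∷ p) =
  ≤-trans (∣p∪q∣≤∣p∣+∣q∣ ⁅ f zero ⁆ (image (λ x → f (suc x)) p))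
          (+-mono-≤ (≤-reflexive (∣⁅x⁆∣≡1 (f zero))) (∣image∣≤∣p∣ (λ x → f (suc x)) p))
∣image∣≤∣p∣ f (false ∷ p) = ∣image∣≤∣p∣ (λ x → f (suc x)) p

x∈p⇒fx∈image : ∀ {n m} (f : Fin n → Fin m) {p : Subset n} {x : Fin n} →
               x ∈ p → f x ∈ image f p
x∈p⇒fx∈image f {true ∷ p}  here       = p⊆p∪q (image (λ x → f (suc x)) p) (x∈⁅x⁆ (f zero))
x∈p⇒fx∈image f {true ∷ p}  (there x∈p) =
  q⊆p∪q ⁅ f zero ⁆ (image (λ x → f (suc x)) p) (x∈p⇒fx∈image (λ x → f (suc x)) x∈p)
x∈p⇒fx∈image f {false ∷ p} (there x∈p) = x∈p⇒fx∈image (λ x → f (suc x)) x∈p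

module _ {m n : ℕ} (G : BipGraph m n) where

  Edge'-irreflexive : ∀ {u} → ¬ Edge' G u u
  Edge'-irreflexive ()

  edge⇒dist1 : ∀ {u v} → Edge' G u v → Dist G u v 1
  edge⇒dist1 e = step e here , λ where
    _ here       → ⊥-elim (Edge'-irreflexive e)
    _ (step _ _) → s≤s z≤n

  twin-dist2 : ∀ {i j} → T (G i j) → Dist G (r j) (r' j) 2
  twin-dist2 {i} {j} adj = step (rb i j adj) (step (br' i j adj) here) , λ where
    _ (step (rb _ _ _) (step _ _)) → s≤s (s≤s z≤n)

  neighbour-onGeodesic : ∀ {i j} → T (G i j) → OnGeodesic G (r j) (b i) (r' j)
  neighbour-onGeodesic {i} {j} adj =
    1 , 1 , 2 , edge⇒dist1 (rb i j adj) , edge⇒dist1 (br' i j adj) , twin-dist2 adj , refl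

  -- The geodesic interval I(r j, r' j) = {r j, r' j} ∪ N(r j).
  Interval : Fin n → V' m n → Set
  Interval j (b i)   = T (G i j)
  Interval j (r j′)  = j′ ≡ j
  Interval j (r' j′) = j′ ≡ j

  short-route⇒Interval : ∀ {j w d₁ d₂} → Walk G (r j) w d₁ → Walk G w (r' j) d₂ →
                         d₁ + d₂ ≤ 2 → Interval j w
  short-route⇒Interval here                     _    _ = refl
  short-route⇒Interval _                        here _ = refl
  short-route⇒Interval (step (rb _ _ adj) here) _    _ = adj
  short-route⇒Interval (step _ (step {ℓ = ℓ} _ _)) (step _ _) (s≤s (s≤s ≤0))
    with () ← m+n≤o⇒n≤o ℓ ≤0

  onGeodesic⇒Interval : ∀ {i j w} → T (G i j) → OnGeodesic G (r j) w (r' j) → Interval j w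
  onGeodesic⇒Interval adj (_ , _ , _ , (p , _) , (q , _) , (_ , shortest) , refl) =
    short-route⇒Interval p q (shortest 2 (proj₁ (twin-dist2 adj)))

  Dominates : Subset m → Set
  Dominates D = ∀ j → ∃[ i ] (i ∈ D × T (G i j))

  GeodesicCover : SubsetV' m n → Set
  GeodesicCover S = ∀ j → ∃[ w ] (w ∈' S × OnGeodesic G (r j) w (r' j))

  Dominates⇒GeodesicCover : ∀ {D} → Dominates D → GeodesicCover (subsetV' D ⊥ ⊥)
  Dominates⇒GeodesicCover dom j =
    let (i , i∈D , adj) = dom j in b i , i∈D , neighbour-onGeodesic adj

  module Projection (pick : Fin n → Fin m) where

    project : V' m n → Fin m
    project (b i)  = i
    project (r j)  = pick j
    project (r' j) = pick j

    projectSubset : SubsetV' m n → Subset m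
    projectSubset (subsetV' SB SR SR') = (SB ∪ image pick SR) ∪ image pick SR'

    ∈'⇒project∈ : ∀ {w} S → w ∈' S → project w ∈ projectSubset S
    ∈'⇒project∈ {b i}  (subsetV' SB SR SR') i∈SB =
      p⊆p∪q (image pick SR') (p⊆p∪q (image pick SR) i∈SB)
    ∈'⇒project∈ {r j}  (subsetV' SB SR SR') j∈SR =
      p⊆p∪q (image pick SR') (q⊆p∪q SB (image pick SR) (x∈p⇒fx∈image pick j∈SR))
    ∈'⇒project∈ {r' j} (subsetV' SB SR SR') j∈SR' =
      q⊆p∪q (SB ∪ image pick SR) (image pick SR') (x∈p⇒fx∈image pick j∈SR')

    ∣projectSubset∣≤size' : ∀ S → ∣ projectSubset S ∣ ≤ size' S
    ∣projectSubset∣≤size' (subsetV' SB SR SR') =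
      ≤-trans (∣p∪q∣≤∣p∣+∣q∣ (SB ∪ image pick SR) (image pick SR'))
        (+-mono-≤ (≤-trans (∣p∪q∣≤∣p∣+∣q∣ SB (image pick SR))
                           (+-monoʳ-≤ ∣ SB ∣ (∣image∣≤∣p∣ pick SR)))
                  (∣image∣≤∣p∣ pick SR'))

    module _ (pick-adjacent : ∀ j → T (G (pick j) j)) where

      Interval⇒project-adjacent : ∀ {j} w → Interval j w → T (G (project w) j)
      Interval⇒project-adjacent (b i)  adj  = adj
      Interval⇒project-adjacent (r j)  refl = pick-adjacent j
      Interval⇒project-adjacent (r' j) refl = pick-adjacent j

      GeodesicCover⇒Dominates : ∀ {S} → GeodesicCover S → Dominates (projectSubset S)
      GeodesicCover⇒Dominates {S} cover j =
        let (w , w∈S , geo) = cover j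
        in project w , ∈'⇒project∈ S w∈S ,
           Interval⇒project-adjacent w (onGeodesic⇒Interval (pick-adjacent j) geo)

size'-blue : ∀ {m n} (D : Subset m) → size' (subsetV' D ⊥ (⊥ {n = n})) ≡ ∣ D ∣
size'-blue {n = n} D rewrite ∣⊥∣≡0 n | +-identityʳ ∣ D ∣ | +-identityʳ ∣ D ∣ = refl

lemma4 : ∀ {m n} (G : BipGraph m n) →
    (∀ (j : Fin n) → ∃[ i ] T (G i j)) →
    (k : ℕ) →
    (∃[ D ] (∣ D ∣ ≤ k × (∀ (j : Fin n) → ∃[ i ] (i ∈ D × T (G i j)))))
    ⇔
    (∃[ S ] (size' S ≤ k × (∀ (j : Fin n) → ∃[ w ] (w ∈' S × OnGeodesic G (r j) w (r' j)))))
lemma4 {n = n} G nb k = mk⇔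
  (λ (D , ∣D∣≤k , dom) →
    subsetV' D ⊥ ⊥ , ≤-trans (≤-reflexive (size'-blue {n = n} D)) ∣D∣≤k ,
    Dominates⇒GeodesicCover G dom)
  (λ (S , size≤k , cover) →
    projectSubset S , ≤-trans (∣projectSubset∣≤size' S) size≤k ,
    GeodesicCover⇒Dominates (λ j → proj₂ (nb j)) cover)
  where open Projection G (λ j → proj₁ (nb j))
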